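{- Let $w=\langle A,D,n\rangle$ be an indexed container over $I$ with trivial reactions, i.e. $D(i,a)=\mathbf 1$ for all $i:I$ and $a:A(i)$. Then $\nu_w$ is a weakly terminal coalgebra for $[\![w^{\bot\bot}]\!]$.
   Context: For an indexed container $w=\langle A,D,n\rangle$ over $I$, the extension is $i\in[\![w]\!](X)=\sum_{a:A(i)}\prod_{d:D(i,a)}X(n(i,a,d))$, and for $h:X\subseteq Y$, $[\![w]\!]_h\langle a,k\rangle=\langle a,\lambda d.h(k\,d)\rangle$. The dual is $w^\bot=\langle A^\bot,D^\bot,n^\bot\rangle$ with $A^\bot(i)=\prod_{a:A(i)}D(i,a)$, $D^\bot(i,f)=A(i)$ and $n^\bot(i,f,a)=n(i,a,f\,a)$; $w^{\bot\bot}=(w^\bot)^\bot$. The coinductive predicate $\nu_w$ has $\nu\mathrm{elim}:\nu_w\subseteq[\![w]\!](\nu_w)$, $\nu\mathrm{intro}\,c:X\subseteq\nu_w$ for $c:X\subseteq[\![w]\!](X)$, and $\nu\mathrm{elim}(\nu\mathrm{intro}\,c\,i\,x)=[\![w]\!]_{\nu\mathrm{intro}\,c}\,i\,(c\,i\,x)$. A predicate $T$ is a weakly terminal coalgebra for $[\![v]\!]$ if there are - $\mathrm{elim}:T\subseteq[\![v]\!](T)$, - for every predicate $X$, $\mathrm{intro}:(X\subseteq[\![v]\!](X))\to(X\subseteq T)$, - proofs of $\mathrm{elim}(\mathrm{intro}\,c\,i\,x)\equiv[\![v]\!]_{\mathrm{intro}\,c}\,i\,(c\,i\,x)$. -}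

module Defs where

open import Data.Unit using (⊤; tt)
open import Data.Product using (Σ; _,_; proj₁; proj₂)
open import Relation.Binary.PropositionalEquality using (_≡_)

record Container (I : Set) : Set₁ where
  constructor ⟨_,_,_⟩
  field
    A : I → Set
    D : (i : I) → A i → Set
    n : (i : I) → (a : A i) → D i a → I
open Container public

Pred : Set → Set₁
Pred I = I → Set

_⊆_ : {I : Set} → Pred I → Pred I → Set
X ⊆ Y = ∀ i → X i → Y i

⟦_⟧ : {I : Set} → Container I → Pred I → Pred I
⟦ w ⟧ X i = Σ (A w i) λ a → (d : D w i a) → X (n w i a d)

⟦_⟧₁ : {I : Set} (w : Container I) {X Y : Pred I} → X ⊆ Y → ⟦ w ⟧ X ⊆ ⟦ w ⟧ Y
⟦ w ⟧₁ h i (a , k) = a , λ d → h (n w i a d) (k d)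

_⊥ : {I : Set} → Container I → Container I
w ⊥ = ⟨ (λ i → (a : A w i) → D w i a)
      , (λ i f → A w i)
      , (λ i f a → n w i a (f a)) ⟩

-- The coinductive predicate ν_w is given in the paper only through
-- νelim, νintro and the computation rule for νelim (νintro c i x); these
-- are exactly the fields of 'WeaklyTerminal w' below.

record WeaklyTerminal {I : Set} (v : Container I) (T : Pred I) : Set₁ where
  field
    elim  : T ⊆ ⟦ v ⟧ T
    intro : {X : Pred I} → X ⊆ ⟦ v ⟧ X → X ⊆ T
    comp  : {X : Pred I} (c : X ⊆ ⟦ v ⟧ X) (i : I) (x : X i) →
            elim i (intro c i x) ≡ ⟦ v ⟧₁ (intro c) i (c i x)

TrivialReactions : {I : Set} (A : I → Set) (n : (i : I) → A i → ⊤ → I) → Container I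
TrivialReactions A n = ⟨ A , (λ _ _ → ⊤) , n ⟩

-- Every ⟦ w ⟧ X maps naturally into ⟦ w ⊥⊥ ⟧ X by sending ⟨ a , k ⟩ to the constant
-- strategy λ _ → a. With trivial reactions A⊥(i) = A(i) → ⊤ is a singleton up to η, so
-- this map has a section (evaluate at the unique element), and both laws hold by refl.
-- A weakly terminal coalgebra for ⟦ w ⟧ transports along any natural map into ⟦ v ⟧
-- that has a section: eliminate with the map, introduce by precomposing the section.
module Submission where

open import Defs
open import Data.Unit using (⊤; tt)
open import Data.Product using (_,_)
open import Relation.Binary.PropositionalEquality using (_≡_; refl; cong; sym; module ≡-Reasoning)
open ≡-Reasoning

module _ {I : Set} {w v : Container I}
         (to   : (X : Pred I) → ⟦ w ⟧ X ⊆ ⟦ v ⟧ X)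
         (from : (X : Pred I) → ⟦ v ⟧ X ⊆ ⟦ w ⟧ X)
         (to-natural : {X Y : Pred I} (h : X ⊆ Y) (i : I) (y : ⟦ w ⟧ X i) →
                       ⟦ v ⟧₁ h i (to X i y) ≡ to Y i (⟦ w ⟧₁ h i y))
         (to∘from : (X : Pred I) (i : I) (y : ⟦ v ⟧ X i) → to X i (from X i y) ≡ y)
         where

  weaklyTerminal-retract : {T : Pred I} → WeaklyTerminal w T → WeaklyTerminal v T
  weaklyTerminal-retract {T} W = record { elim = elim′ ; intro = intro′ ; comp = comp′ }
    where
    open WeaklyTerminal W

    elim′ : T ⊆ ⟦ v ⟧ T
    elim′ i t = to T i (elim i t)

    intro′ : {X : Pred I} → X ⊆ ⟦ v ⟧ X → X ⊆ T
    intro′ {X} c = intro (λ i x → from X i (c i x))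

    comp′ : {X : Pred I} (c : X ⊆ ⟦ v ⟧ X) (i : I) (x : X i) →
            elim′ i (intro′ c i x) ≡ ⟦ v ⟧₁ (intro′ c) i (c i x)
    comp′ {X} c i x = begin
      to T i (elim i (intro′ c i x))
        ≡⟨ cong (to T i) (comp (λ i x → from X i (c i x)) i x) ⟩
      to T i (⟦ w ⟧₁ (intro′ c) i (from X i (c i x)))
        ≡⟨ sym (to-natural (intro′ c) i (from X i (c i x))) ⟩
      ⟦ v ⟧₁ (intro′ c) i (to X i (from X i (c i x)))
        ≡⟨ cong (⟦ v ⟧₁ (intro′ c) i) (to∘from X i (c i x)) ⟩
      ⟦ v ⟧₁ (intro′ c) i (c i x)
        ∎

⟦⟧-into-⊥⊥ : {I : Set} (w : Container I) (X : Pred I) → ⟦ w ⟧ X ⊆ ⟦ (w ⊥) ⊥ ⟧ X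
⟦⟧-into-⊥⊥ w X i (a , k) = (λ _ → a) , λ f → k (f a)

⟦⟧-into-⊥⊥-natural : {I : Set} (w : Container I) {X Y : Pred I} (h : X ⊆ Y) (i : I)
                     (y : ⟦ w ⟧ X i) →
                     ⟦ (w ⊥) ⊥ ⟧₁ h i (⟦⟧-into-⊥⊥ w X i y) ≡ ⟦⟧-into-⊥⊥ w Y i (⟦ w ⟧₁ h i y)
⟦⟧-into-⊥⊥-natural w h i y = refl

module _ {I : Set} (A : I → Set) (n : (i : I) → A i → ⊤ → I) where

  private
    w : Container I
    w = TrivialReactions A n

  ⟦⟧-⊥⊥-trivialReactions-out : (X : Pred I) → ⟦ (w ⊥) ⊥ ⟧ X ⊆ ⟦ w ⟧ X
  ⟦⟧-⊥⊥-trivialReactions-out X i (g , k) = g (λ _ → tt) , λ _ → k (λ _ → tt)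

  ⟦⟧-⊥⊥-trivialReactions-inverse : (X : Pred I) (i : I) (y : ⟦ (w ⊥) ⊥ ⟧ X i) →
                                   ⟦⟧-into-⊥⊥ w X i (⟦⟧-⊥⊥-trivialReactions-out X i y) ≡ y
  ⟦⟧-⊥⊥-trivialReactions-inverse X i y = refl

lemma5p5 : {I : Set} (A : I → Set) (n : (i : I) → A i → ⊤ → I) →
    (νw : Pred I) → WeaklyTerminal (TrivialReactions A n) νw →
    WeaklyTerminal (((TrivialReactions A n) ⊥) ⊥) νw
lemma5p5 A n νw =
  weaklyTerminal-retract
    (⟦⟧-into-⊥⊥ w)
    (⟦⟧-⊥⊥-trivialReactions-out A n)
    (⟦⟧-into-⊥⊥-natural w)
    (⟦⟧-⊥⊥-trivialReactions-inverse A n)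
  where
  w : Container _
  w = TrivialReactions A n
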